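{- For any two lattice points $u,v\in\mathbb{Z}^2$, let $\ell(u,v)$ be the minimal length of an increasing path from $u$ to $v$; the path is not restricted to any region. Let $d_\infty(u,v)$ be the sup-norm distance between them. Then $|\ell(u,v)-2d_\infty(u,v)|\le 1$.
   Context: Color the unit squares of $\mathbb{Z}^2$ black and white in checkerboard fashion. An increasing path is a sequence of lattice points, consecutive ones joined by unit lattice edges, such that every edge, oriented in the direction of travel, has a black square on its left. Its length is the number of edges. -}

module Defs where

open import Data.Nat using (ℕ; zero; suc; _⊔_)
open import Data.Integer using (ℤ; _+_; _-_; ∣_∣; +_)
open import Data.Integer.Divisibility using (_∣_)
open import Data.Product using (_×_; _,_)

Point : Set
Point = ℤ × ℤ

-- Unit square with lower-left corner (i , j).  Checkerboard colouring:
-- the square (i , j) is black iff i + j is even.  (The other colouring is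
-- a unit translate of this one, and the statement is translation invariant.)
Black : ℤ → ℤ → Set
Black i j = (+ 2) ∣ (i + j)

-- One unit edge from p to q, oriented from p to q, with a black square on
-- its left.  For an edge leaving (x , y):
--   right (x+1 , y): left square is (x   , y  )
--   left  (x-1 , y): left square is (x-1 , y-1)
--   up    (x , y+1): left square is (x-1 , y  )
--   down  (x , y-1): left square is (x   , y-1)
data Step : Point → Point → Set where
  right : ∀ {x y} → Black x y → Step (x , y) (x + + 1 , y)
  left  : ∀ {x y} → Black (x - + 1) (y - + 1) → Step (x , y) (x - + 1 , y)
  up    : ∀ {x y} → Black (x - + 1) y → Step (x , y) (x , y + + 1)
  down  : ∀ {x y} → Black x (y - + 1) → Step (x , y) (x , y - + 1)

data IncPath : Point → Point → Set where
  []  : ∀ {u} → IncPath u u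
  _∷_ : ∀ {u w v} → Step u w → IncPath w v → IncPath u v

length : ∀ {u v} → IncPath u v → ℕ
length []       = zero
length (_ ∷ p)  = suc (length p)

d∞ : Point → Point → ℕ
d∞ (x₁ , y₁) (x₂ , y₂) = ∣ x₁ - x₂ ∣ ⊔ ∣ y₁ - y₂ ∣

-- The squares (x , y) and (x - 1 , y - 1) have one colour and the squares
-- (x - 1 , y) and (x , y - 1) the other.  So at the point (x , y) an
-- increasing path can move only horizontally (either way) if the square
-- (x , y) is black and only vertically if it is white, and every step flips
-- that colour: increasing paths are the paths that alternate horizontal and
-- vertical unit steps, the first one being fixed by the colour at the start.
-- With a = ∣x - x′∣ and b = ∣y - y′∣ the shortest length to (x′ , y′) should
-- then be the potential  zigzag a b  when starting horizontally, zigzag b a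
-- otherwise.  It drops by at most one along any step, and away from the
-- target some step lowers it by exactly one, so it is indeed the length of a
-- shortest increasing path; and zigzag a b is within one of 2 max(a, b).
module Submission where

open import Defs
open import Data.Nat using (ℕ; _≤_; _+_; _*_)
open import Data.Product using (Σ; _×_)

open import Data.Integer as ℤ using (ℤ; +_; -[1+_]; ∣_∣; 1ℤ; -1ℤ)
import Data.Integer.Properties as ℤₚ
open import Algebra.Properties.CommutativeSemigroup ℤₚ.+-commutativeSemigroup using (xy∙z≈xz∙y)
open import Data.Nat using (zero; suc; z≤n; s≤s; _⊔_)
open import Data.Nat.Divisibility
  using (_∣_; _∤_; _∣?_; _∣0; ∣-refl; ∣m∣n⇒∣m+n; ∣m+n∣m⇒∣n; ∣1⇒≡1)
open import Data.Nat.Properties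
  using ( ≤-refl; ≤-reflexive; ≤-trans; m≤n+m; n≤1+n; *-suc; ⊔-comm; +-comm; suc-injective
        ; module ≤-Reasoning)
open import Data.Product using (_,_)
open import Data.Sum using (_⊎_; inj₁; inj₂; [_,_]′; map; swap)
open import Function using (_∘_; id; flip; _⇔_; mk⇔; Equivalence)
open import Relation.Binary.PropositionalEquality
  using (_≡_; refl; sym; trans; cong; cong₂; subst; module ≡-Reasoning)
open import Relation.Nullary using (¬_; Dec; yes; no; contradiction)

open Equivalence using (to; from)

module PotentialDistance {v : Point} (φ : Point → ℕ)
  (φ-target    : φ v ≡ 0)
  (φ≡0⇒≡       : ∀ {u} → φ u ≡ 0 → u ≡ v)
  (φ-lipschitz : ∀ {u w} → Step u w → φ u ≤ suc (φ w))
  (φ-descent   : ∀ {u n} → φ u ≡ suc n → Σ Point λ w → Step u w × φ w ≡ n)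
  where

  φ≤length : ∀ {u} (q : IncPath u v) → φ u ≤ length q
  φ≤length []      = ≤-reflexive φ-target
  φ≤length (s ∷ q) = ≤-trans (φ-lipschitz s) (s≤s (φ≤length q))

  descending-path : ∀ {u n} → φ u ≡ n → Σ (IncPath u v) λ p → length p ≡ n
  descending-path {n = zero} eq with φ≡0⇒≡ eq
  ... | refl = [] , refl
  descending-path {n = suc n} eq with φ-descent eq
  ... | _ , s , eq′ with descending-path eq′
  ...   | p , length-p = s ∷ p , cong suc length-p

  shortest-path : ∀ u →
    Σ (IncPath u v) λ p → ((q : IncPath u v) → length p ≤ length q) × length p ≡ φ u
  shortest-path u with descending-path {u} refl
  ... | p , length-p = p , (λ q → subst (_≤ length q) (sym length-p) (φ≤length q)) , length-p

Adjacentℕ : ℕ → ℕ → Set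
Adjacentℕ m n = n ≡ suc m ⊎ m ≡ suc n

WithinOne : ℕ → ℕ → Set
WithinOne m n = m ≤ n + 1 × n ≤ m + 1

-- zigzag a b is the length of a shortest path of alternately horizontal
-- and vertical unit steps, starting horizontally, that moves a units
-- horizontally and b units vertically.  When a = 0 the path has to make
-- detours: sideways, up, back, up covers two vertical units, and sideways,
-- up, back a last one.
zigzag : ℕ → ℕ → ℕ
zigzag zero    zero          = 0
zigzag zero    (suc zero)    = 3
zigzag zero    (suc (suc b)) = 4 + zigzag zero b
zigzag (suc a) b             = suc (zigzag b a)

zigzag-mono-2+ : ∀ a b → zigzag a b ≤ zigzag (2 + a) b
zigzag-mono-2+ zero    zero          = z≤n
zigzag-mono-2+ zero    (suc zero)    = ≤-refl
zigzag-mono-2+ zero    (suc (suc b)) = ≤-refl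
zigzag-mono-2+ (suc a) zero          = m≤n+m _ 4
zigzag-mono-2+ (suc a) (suc b)       = s≤s (s≤s (zigzag-mono-2+ a b))

zigzag-adjacent : ∀ {a a′} b → Adjacentℕ a a′ → zigzag a b ≤ suc (zigzag b a′)
zigzag-adjacent {a} b (inj₁ refl) = zigzag-mono-2+ a b
zigzag-adjacent     b (inj₂ refl) = ≤-refl

zigzag≡0⇒≡0 : ∀ a b → zigzag a b ≡ 0 → a ≡ 0 × b ≡ 0
zigzag≡0⇒≡0 zero    zero          _ = refl , refl
zigzag≡0⇒≡0 zero    (suc zero)    ()
zigzag≡0⇒≡0 zero    (suc (suc b)) ()
zigzag≡0⇒≡0 (suc a) _             ()

zigzag[0,1+b]≡1+zigzag[1+b,1] : ∀ b → zigzag 0 (suc b) ≡ suc (zigzag (suc b) 1)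
zigzag[0,1+b]≡1+zigzag[1+b,1] zero    = refl
zigzag[0,1+b]≡1+zigzag[1+b,1] (suc b) = refl

within-double-2+ : ∀ {m} k → WithinOne m (2 * k) → WithinOne (2 + m) (2 * suc k)
within-double-2+ {m} k (m≤ , ≤m) =
  subst (WithinOne (2 + m)) (sym (*-suc 2 k)) (s≤s (s≤s m≤) , s≤s (s≤s ≤m))

zigzag-within-double : ∀ a b → WithinOne (zigzag a b) (2 * (a ⊔ b))
zigzag-within-double zero                zero          = z≤n , z≤n
zigzag-within-double zero                (suc zero)    = ≤-refl , s≤s (s≤s z≤n)
zigzag-within-double zero                (suc (suc b)) =
  within-double-2+ (suc b) (within-double-2+ b (zigzag-within-double 0 b))
zigzag-within-double (suc zero)          zero          = s≤s z≤n , ≤-refl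
zigzag-within-double (suc (suc zero))    zero          = n≤1+n 4 , n≤1+n 4
zigzag-within-double (suc (suc (suc a))) zero          =
  within-double-2+ (suc (suc a)) (within-double-2+ (suc a) (zigzag-within-double (suc a) 0))
zigzag-within-double (suc a)             (suc b)       =
  within-double-2+ (a ⊔ b) (zigzag-within-double a b)

2∣n⇒2∤1+n : ∀ {n} → 2 ∣ n → 2 ∤ suc n
2∣n⇒2∤1+n {n} 2∣n 2∣1+n with ∣1⇒≡1 (∣m+n∣m⇒∣n (subst (2 ∣_) (+-comm 1 n) 2∣1+n) 2∣n)
... | ()

2∣n⊎2∣1+n : ∀ n → (2 ∣ n) ⊎ (2 ∣ suc n)
2∣n⊎2∣1+n zero    = inj₁ (2 ∣0)
2∣n⊎2∣1+n (suc n) = [ inj₂ ∘ ∣m∣n⇒∣m+n ∣-refl , inj₁ ]′ (2∣n⊎2∣1+n n)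

adjacent-2∣⇒2∤ : ∀ {m n} → Adjacentℕ m n → 2 ∣ m → 2 ∤ n
adjacent-2∣⇒2∤ (inj₁ refl) 2∣m     = 2∣n⇒2∤1+n 2∣m
adjacent-2∣⇒2∤ (inj₂ refl) 2∣1+n 2∣n = 2∣n⇒2∤1+n 2∣n 2∣1+n

adjacent-2∤⇒2∣ : ∀ {m n} → Adjacentℕ m n → 2 ∤ m → 2 ∣ n
adjacent-2∤⇒2∣ {m}     (inj₁ refl) 2∤m   = [ flip contradiction 2∤m , id ]′ (2∣n⊎2∣1+n m)
adjacent-2∤⇒2∣ {n = n} (inj₂ refl) 2∤1+n = [ id , flip contradiction 2∤1+n ]′ (2∣n⊎2∣1+n n)

Adjacentℤ : ℤ → ℤ → Set
Adjacentℤ i j = j ≡ i ℤ.+ 1ℤ ⊎ i ≡ j ℤ.+ 1ℤ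

Adjacentℤ-sym : ∀ {i j} → Adjacentℤ i j → Adjacentℤ j i
Adjacentℤ-sym = swap

+1-adjacent : ∀ i → Adjacentℤ i (i ℤ.+ 1ℤ)
+1-adjacent i = inj₁ refl

-1-adjacent : ∀ i → Adjacentℤ (i ℤ.- 1ℤ) i
-1-adjacent i = inj₁ (sym (trans (ℤₚ.+-assoc i -1ℤ 1ℤ) (ℤₚ.+-identityʳ i)))

Adjacentℤ-+ʳ : ∀ {i j} k → Adjacentℤ i j → Adjacentℤ (i ℤ.+ k) (j ℤ.+ k)
Adjacentℤ-+ʳ {i} k (inj₁ refl) = inj₁ (xy∙z≈xz∙y i 1ℤ k)
Adjacentℤ-+ʳ {j = j} k (inj₂ refl) = inj₂ (xy∙z≈xz∙y j 1ℤ k)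

Adjacentℤ-+ˡ : ∀ {i j} k → Adjacentℤ i j → Adjacentℤ (k ℤ.+ i) (k ℤ.+ j)
Adjacentℤ-+ˡ {i} k (inj₁ refl) = inj₁ (sym (ℤₚ.+-assoc k i 1ℤ))
Adjacentℤ-+ˡ {j = j} k (inj₂ refl) = inj₂ (sym (ℤₚ.+-assoc k j 1ℤ))

∣i∣-adjacent-∣i+1∣ : ∀ i → Adjacentℕ ∣ i ∣ ∣ i ℤ.+ 1ℤ ∣
∣i∣-adjacent-∣i+1∣ (+ k)        = inj₁ (+-comm k 1)
∣i∣-adjacent-∣i+1∣ -[1+ zero ]  = inj₂ refl
∣i∣-adjacent-∣i+1∣ -[1+ suc k ] = inj₂ refl

∣-∣-adjacent : ∀ {i j} → Adjacentℤ i j → Adjacentℕ ∣ i ∣ ∣ j ∣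
∣-∣-adjacent {i} (inj₁ refl) = ∣i∣-adjacent-∣i+1∣ i
∣-∣-adjacent {j = j} (inj₂ refl) = swap (∣i∣-adjacent-∣i+1∣ j)

adjacentℤ-2∣⇒2∤ : ∀ {i j} → Adjacentℤ i j → 2 ∣ ∣ i ∣ → 2 ∤ ∣ j ∣
adjacentℤ-2∣⇒2∤ = adjacent-2∣⇒2∤ ∘ ∣-∣-adjacent

adjacentℤ-2∤⇒2∣ : ∀ {i j} → Adjacentℤ i j → 2 ∤ ∣ i ∣ → 2 ∣ ∣ j ∣
adjacentℤ-2∤⇒2∣ = adjacent-2∤⇒2∣ ∘ ∣-∣-adjacent

∣i-j∣≡0⇒i≡j : ∀ i j → ∣ i ℤ.- j ∣ ≡ 0 → i ≡ j
∣i-j∣≡0⇒i≡j i j = ℤₚ.i-j≡0⇒i≡j i j ∘ ℤₚ.∣i∣≡0⇒i≡0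

∣i∣≡1+k⇒∣i±1∣≡k : ∀ i {k} → ∣ i ∣ ≡ suc k → ∣ i ℤ.+ 1ℤ ∣ ≡ k ⊎ ∣ i ℤ.- 1ℤ ∣ ≡ k
∣i∣≡1+k⇒∣i±1∣≡k (+ suc k)      refl = inj₂ refl
∣i∣≡1+k⇒∣i±1∣≡k -[1+ zero ]    refl = inj₁ refl
∣i∣≡1+k⇒∣i±1∣≡k -[1+ suc k ]   refl = inj₁ refl

zigzag-descent : ∀ i b {n} → zigzag ∣ i ∣ b ≡ suc n →
                 zigzag b ∣ i ℤ.+ 1ℤ ∣ ≡ n ⊎ zigzag b ∣ i ℤ.- 1ℤ ∣ ≡ n
zigzag-descent i b       eq with ∣ i ∣ in ∣i∣≡
zigzag-descent i b {n} eq | suc k = map toward toward (∣i∣≡1+k⇒∣i±1∣≡k i ∣i∣≡)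
  where
  toward : ∀ {m} → m ≡ k → zigzag b m ≡ n
  toward e = trans (cong (zigzag b) e) (suc-injective eq)
zigzag-descent i (suc b) eq | zero  = inj₁ (begin
  zigzag (suc b) ∣ i ℤ.+ 1ℤ ∣  ≡⟨ cong (λ j → zigzag (suc b) ∣ j ℤ.+ 1ℤ ∣) (ℤₚ.∣i∣≡0⇒i≡0 {i} ∣i∣≡) ⟩
  zigzag (suc b) 1             ≡⟨ suc-injective (trans (sym (zigzag[0,1+b]≡1+zigzag[1+b,1] b)) eq) ⟩
  _                            ∎)
  where open ≡-Reasoning

black? : ∀ x y → Dec (Black x y)
black? x y = 2 ∣? ∣ x ℤ.+ y ∣

module _ (x y : ℤ) where

  private
    west : Adjacentℤ ((x ℤ.- 1ℤ) ℤ.+ y) (x ℤ.+ y)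
    west = Adjacentℤ-+ʳ y (-1-adjacent x)

    south : Adjacentℤ (x ℤ.+ (y ℤ.- 1ℤ)) (x ℤ.+ y)
    south = Adjacentℤ-+ˡ x (-1-adjacent y)

    south-west : Adjacentℤ ((x ℤ.- 1ℤ) ℤ.+ (y ℤ.- 1ℤ)) ((x ℤ.- 1ℤ) ℤ.+ y)
    south-west = Adjacentℤ-+ˡ (x ℤ.- 1ℤ) (-1-adjacent y)

  left-allowed⇔black : Black (x ℤ.- 1ℤ) (y ℤ.- 1ℤ) ⇔ Black x y
  left-allowed⇔black =
    mk⇔ (adjacentℤ-2∤⇒2∣ west ∘ adjacentℤ-2∣⇒2∤ south-west)
        (adjacentℤ-2∤⇒2∣ (Adjacentℤ-sym south-west) ∘ adjacentℤ-2∣⇒2∤ (Adjacentℤ-sym west))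

  up-allowed⇔white : Black (x ℤ.- 1ℤ) y ⇔ (¬ Black x y)
  up-allowed⇔white = mk⇔ (adjacentℤ-2∣⇒2∤ west) (adjacentℤ-2∤⇒2∣ (Adjacentℤ-sym west))

  down-allowed⇔white : Black x (y ℤ.- 1ℤ) ⇔ (¬ Black x y)
  down-allowed⇔white = mk⇔ (adjacentℤ-2∣⇒2∤ south) (adjacentℤ-2∤⇒2∣ (Adjacentℤ-sym south))

potential : Point → Point → ℕ
potential (x , y) (x′ , y′) with black? x y
... | yes _ = zigzag ∣ x ℤ.- x′ ∣ ∣ y ℤ.- y′ ∣
... | no  _ = zigzag ∣ y ℤ.- y′ ∣ ∣ x ℤ.- x′ ∣

potential-black : ∀ x y {x′ y′} → Black x y →
                  potential (x , y) (x′ , y′) ≡ zigzag ∣ x ℤ.- x′ ∣ ∣ y ℤ.- y′ ∣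
potential-black x y b with black? x y
... | yes _ = refl
... | no ¬b = contradiction b ¬b

potential-white : ∀ x y {x′ y′} → ¬ Black x y →
                  potential (x , y) (x′ , y′) ≡ zigzag ∣ y ℤ.- y′ ∣ ∣ x ℤ.- x′ ∣
potential-white x y ¬b with black? x y
... | yes b = contradiction b ¬b
... | no  _ = refl

potential-horizontal : ∀ x y {x′ y′ x₁} → Black x y → Adjacentℤ x x₁ →
                       potential (x₁ , y) (x′ , y′) ≡ zigzag ∣ y ℤ.- y′ ∣ ∣ x₁ ℤ.- x′ ∣
potential-horizontal x y {x₁ = x₁} b x~x₁ =
  potential-white x₁ y (adjacentℤ-2∣⇒2∤ (Adjacentℤ-+ʳ y x~x₁) b)

potential-vertical : ∀ x y {x′ y′ y₁} → ¬ Black x y → Adjacentℤ y y₁ →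
                     potential (x , y₁) (x′ , y′) ≡ zigzag ∣ x ℤ.- x′ ∣ ∣ y₁ ℤ.- y′ ∣
potential-vertical x y {y₁ = y₁} ¬b y~y₁ =
  potential-black x y₁ (adjacentℤ-2∤⇒2∣ (Adjacentℤ-+ˡ x y~y₁) ¬b)

horizontal-lipschitz : ∀ x y {x′ y′ x₁} → Black x y → Adjacentℤ x x₁ →
                       potential (x , y) (x′ , y′) ≤ suc (potential (x₁ , y) (x′ , y′))
horizontal-lipschitz x y {x′} {y′} {x₁} b x~x₁ = begin
  potential (x , y) (x′ , y′)                 ≡⟨ potential-black x y b ⟩
  zigzag ∣ x ℤ.- x′ ∣ ∣ y ℤ.- y′ ∣            ≤⟨ zigzag-adjacent _ (∣-∣-adjacent (Adjacentℤ-+ʳ (ℤ.- x′) x~x₁)) ⟩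
  suc (zigzag ∣ y ℤ.- y′ ∣ ∣ x₁ ℤ.- x′ ∣)     ≡⟨ cong suc (potential-horizontal x y b x~x₁) ⟨
  suc (potential (x₁ , y) (x′ , y′))          ∎
  where open ≤-Reasoning

vertical-lipschitz : ∀ x y {x′ y′ y₁} → ¬ Black x y → Adjacentℤ y y₁ →
                     potential (x , y) (x′ , y′) ≤ suc (potential (x , y₁) (x′ , y′))
vertical-lipschitz x y {x′} {y′} {y₁} ¬b y~y₁ = begin
  potential (x , y) (x′ , y′)                 ≡⟨ potential-white x y ¬b ⟩
  zigzag ∣ y ℤ.- y′ ∣ ∣ x ℤ.- x′ ∣            ≤⟨ zigzag-adjacent _ (∣-∣-adjacent (Adjacentℤ-+ʳ (ℤ.- y′) y~y₁)) ⟩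
  suc (zigzag ∣ x ℤ.- x′ ∣ ∣ y₁ ℤ.- y′ ∣)     ≡⟨ cong suc (potential-vertical x y ¬b y~y₁) ⟨
  suc (potential (x , y₁) (x′ , y′))          ∎
  where open ≤-Reasoning

potential-lipschitz : ∀ v {u w} → Step u w → potential u v ≤ suc (potential w v)
potential-lipschitz _ (right {x} {y} b) =
  horizontal-lipschitz x y b (+1-adjacent x)
potential-lipschitz _ (left {x} {y} b) =
  horizontal-lipschitz x y (to (left-allowed⇔black x y) b) (Adjacentℤ-sym (-1-adjacent x))
potential-lipschitz _ (up {x} {y} b) =
  vertical-lipschitz x y (to (up-allowed⇔white x y) b) (+1-adjacent y)
potential-lipschitz _ (down {x} {y} b) =
  vertical-lipschitz x y (to (down-allowed⇔white x y) b) (Adjacentℤ-sym (-1-adjacent y))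

potential-descent : ∀ u v {n} → potential u v ≡ suc n →
                    Σ Point λ w → Step u w × potential w v ≡ n
potential-descent (x , y) (x′ , y′) {n} eq with black? x y
... | yes b =
  [ (λ e → (x ℤ.+ 1ℤ , y) , right b , horizontal 1ℤ (+1-adjacent x) e)
  , (λ e → (x ℤ.- 1ℤ , y) , left (from (left-allowed⇔black x y) b) ,
           horizontal -1ℤ (Adjacentℤ-sym (-1-adjacent x)) e)
  ]′ (zigzag-descent (x ℤ.- x′) ∣ y ℤ.- y′ ∣ eq)
  where
  horizontal : ∀ d → Adjacentℤ x (x ℤ.+ d) → zigzag ∣ y ℤ.- y′ ∣ ∣ (x ℤ.- x′) ℤ.+ d ∣ ≡ n →
               potential (x ℤ.+ d , y) (x′ , y′) ≡ n
  horizontal d x~x+d e = begin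
    potential (x ℤ.+ d , y) (x′ , y′)           ≡⟨ potential-horizontal x y b x~x+d ⟩
    zigzag (∣ y ℤ.- y′ ∣) (∣ x ℤ.+ d ℤ.- x′ ∣)  ≡⟨ cong (zigzag ∣ y ℤ.- y′ ∣ ∘ ∣_∣) (xy∙z≈xz∙y x d (ℤ.- x′)) ⟩
    zigzag (∣ y ℤ.- y′ ∣) (∣ x ℤ.- x′ ℤ.+ d ∣)  ≡⟨ e ⟩
    n                                           ∎
    where open ≡-Reasoning
... | no ¬b =
  [ (λ e → (x , y ℤ.+ 1ℤ) , up (from (up-allowed⇔white x y) ¬b) , vertical 1ℤ (+1-adjacent y) e)
  , (λ e → (x , y ℤ.- 1ℤ) , down (from (down-allowed⇔white x y) ¬b) ,
           vertical -1ℤ (Adjacentℤ-sym (-1-adjacent y)) e)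
  ]′ (zigzag-descent (y ℤ.- y′) ∣ x ℤ.- x′ ∣ eq)
  where
  vertical : ∀ d → Adjacentℤ y (y ℤ.+ d) → zigzag ∣ x ℤ.- x′ ∣ ∣ (y ℤ.- y′) ℤ.+ d ∣ ≡ n →
             potential (x , y ℤ.+ d) (x′ , y′) ≡ n
  vertical d y~y+d e = begin
    potential (x , y ℤ.+ d) (x′ , y′)           ≡⟨ potential-vertical x y ¬b y~y+d ⟩
    zigzag (∣ x ℤ.- x′ ∣) (∣ y ℤ.+ d ℤ.- y′ ∣)  ≡⟨ cong (zigzag ∣ x ℤ.- x′ ∣ ∘ ∣_∣) (xy∙z≈xz∙y y d (ℤ.- y′)) ⟩
    zigzag (∣ x ℤ.- x′ ∣) (∣ y ℤ.- y′ ℤ.+ d ∣)  ≡⟨ e ⟩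
    n                                           ∎
    where open ≡-Reasoning

potential≡0⇒≡ : ∀ u v → potential u v ≡ 0 → u ≡ v
potential≡0⇒≡ (x , y) (x′ , y′) eq with black? x y
... | yes _ = let a≡0 , b≡0 = zigzag≡0⇒≡0 _ _ eq in
              cong₂ _,_ (∣i-j∣≡0⇒i≡j x x′ a≡0) (∣i-j∣≡0⇒i≡j y y′ b≡0)
... | no  _ = let b≡0 , a≡0 = zigzag≡0⇒≡0 _ _ eq in
              cong₂ _,_ (∣i-j∣≡0⇒i≡j x x′ a≡0) (∣i-j∣≡0⇒i≡j y y′ b≡0)

potential-self : ∀ v → potential v v ≡ 0
potential-self (x , y) with black? x y
... | yes _ rewrite ℤₚ.+-inverseʳ x | ℤₚ.+-inverseʳ y = refl
... | no  _ rewrite ℤₚ.+-inverseʳ x | ℤₚ.+-inverseʳ y = refl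

potential-within-double : ∀ u v → WithinOne (potential u v) (2 * d∞ u v)
potential-within-double (x , y) (x′ , y′) with black? x y
... | yes _ = zigzag-within-double (∣ x ℤ.- x′ ∣) (∣ y ℤ.- y′ ∣)
... | no  _ = subst (WithinOne (zigzag (∣ y ℤ.- y′ ∣) (∣ x ℤ.- x′ ∣)) ∘ (2 *_))
                    (⊔-comm (∣ y ℤ.- y′ ∣) (∣ x ℤ.- x′ ∣))
                    (zigzag-within-double (∣ y ℤ.- y′ ∣) (∣ x ℤ.- x′ ∣))

shortest-increasing-path : ∀ u v →
  Σ (IncPath u v) λ p → ((q : IncPath u v) → length p ≤ length q) × length p ≡ potential u v
shortest-increasing-path u v = shortest-path u
  where
  open PotentialDistance (λ w → potential w v) (potential-self v) (potential≡0⇒≡ _ v)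
                         (potential-lipschitz v) (potential-descent _ v)

lemma3p3 : (u v : Point) →
    Σ (IncPath u v) λ p →
      ((q : IncPath u v) → length p ≤ length q) ×
      (length p ≤ 2 * d∞ u v + 1) × (2 * d∞ u v ≤ length p + 1)
lemma3p3 u v with shortest-increasing-path u v
... | p , shortest , length-p =
  p , shortest ,
  subst (λ ℓ → WithinOne ℓ (2 * d∞ u v)) (sym length-p) (potential-within-double u v)
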